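{- Let $F$ be a face of $\mathrm{PM}$ and let $S\subseteq T$ be two sets in $\mathrm{tight}(F)$. If $T$ is $F$-contractible, then $S$ is $F$-contractible.
   Context: $G=(V,E)$ is a fixed undirected simple graph. For $S\subseteq V$, $\delta(S)$ is the set of edges with exactly one endpoint in $S$ and $E(S)$ the set of edges with both endpoints in $S$; $x(\delta(S))=\sum_{e\in\delta(S)}x_e$. $\mathrm{PM}=\{x\in\mathbb{R}^E:x(\delta(v))=1\ \forall v,\ x(\delta(S))\ge1\ \forall S\subseteq V\text{ odd},\ x\ge0\}$ is the perfect matching polytope (convex hull of indicator vectors of perfect matchings); a face is a nonempty subset obtained by setting some of these inequalities to equality; a perfect matching is in $F$ if its indicator vector is in $F$. $\mathrm{tight}(F)=\{S\subseteq V:|S|\text{ odd},\ x(\delta(S))=1\ \forall x\in F\}$. For $S\in\mathrm{tight}(F)$, $S$ is $F$-contractible if for every $e\in\delta(S)$ there are no two perfect matchings in $F$ which both contain $e$ and differ on $E(S)$.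
   Formalization: Points of the polytope PM and of the face F, including the witness of nonemptiness and the points defining tight(F), have rational coordinates, lying in ℚ^E rather than $\mathbb{R}^E$. -}

module Defs where

open import Data.Nat as ℕ using (ℕ; zero; suc)
open import Data.Bool using (Bool; true; false; if_then_else_; _xor_; _∧_)
open import Data.Fin using (Fin; zero; suc)
open import Data.Fin.Subset using (Subset; ⁅_⁆; ∣_∣; _⊆_)
open import Data.Vec using (lookup)
open import Data.Product using (Σ; ∃; _×_; _,_; proj₁; proj₂)
open import Data.Sum using (_⊎_)
open import Data.Rational using (ℚ; 0ℚ; 1ℚ; _+_; _≤_)
open import Relation.Binary.PropositionalEquality using (_≡_; _≢_)
open import Relation.Nullary using (¬_)
open import Function using (_∘_)

sumℚ : ∀ {m} → (Fin m → ℚ) → ℚ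
sumℚ {zero}  f = 0ℚ
sumℚ {suc m} f = f zero + sumℚ (f ∘ suc)

countℕ : ∀ {m} → (Fin m → Bool) → ℕ
countℕ {zero}  f = 0
countℕ {suc m} f = (if f zero then 1 else 0) ℕ.+ countℕ (f ∘ suc)

Odd : ℕ → Set
Odd k = Σ ℕ λ j → k ≡ suc (2 ℕ.* j)

SamePair : ∀ {n} → Fin n × Fin n → Fin n × Fin n → Set
SamePair (a , b) (c , d) = (a ≡ c × b ≡ d) ⊎ (a ≡ d × b ≡ c)

record Graph (n : ℕ) : Set where
  field
    m        : ℕ
    ends     : Fin m → Fin n × Fin n
    loopless : ∀ e → proj₁ (ends e) ≢ proj₂ (ends e)
    simple   : ∀ e f → SamePair (ends e) (ends f) → e ≡ f

module _ {n : ℕ} (G : Graph n) where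
  open Graph G

  Vec𝔼 : Set
  Vec𝔼 = Fin m → ℚ

  crosses : Subset n → Fin m → Bool
  crosses S e = lookup S (proj₁ (ends e)) xor lookup S (proj₂ (ends e))

  inside : Subset n → Fin m → Bool
  inside S e = lookup S (proj₁ (ends e)) ∧ lookup S (proj₂ (ends e))

  xδ : Vec𝔼 → Subset n → ℚ
  xδ x S = sumℚ (λ e → if crosses S e then x e else 0ℚ)

  OddSet : Subset n → Set
  OddSet S = Odd ∣ S ∣

  InPM : Vec𝔼 → Set
  InPM x = (∀ v → xδ x ⁅ v ⁆ ≡ 1ℚ)
         × (∀ S → OddSet S → 1ℚ ≤ xδ x S)
         × (∀ e → 0ℚ ≤ x e)

  -- A face: a nonempty set obtained by turning some of the defining
  -- inequalities (edges in Z: x_e ≥ 0; odd sets in 𝒮: x(δ(S)) ≥ 1) into equalities.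
  record Face : Set₁ where
    field
      Z : Fin m → Set
      𝒮 : Subset n → Set

    InFace : Vec𝔼 → Set
    InFace x = InPM x
             × (∀ e → Z e → x e ≡ 0ℚ)
             × (∀ S → OddSet S → 𝒮 S → xδ x S ≡ 1ℚ)

    field
      nonempty : ∃ InFace

  open Face public

  χ : (Fin m → Bool) → Vec𝔼
  χ M e = if M e then 1ℚ else 0ℚ

  IsPerfectMatching : (Fin m → Bool) → Set
  IsPerfectMatching M = ∀ v → countℕ (λ e → M e ∧ crosses ⁅ v ⁆ e) ≡ 1

  PMIn : Face → (Fin m → Bool) → Set
  PMIn F M = IsPerfectMatching M × InFace F (χ M)

  tight : Face → Subset n → Set
  tight F S = OddSet S × (∀ x → InFace F x → xδ x S ≡ 1ℚ)

  Contractible : Face → Subset n → Set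
  Contractible F S =
    ∀ e → crosses S e ≡ true →
      ¬ (Σ (Fin m → Bool) λ M₁ → Σ (Fin m → Bool) λ M₂ →
           PMIn F M₁ × PMIn F M₂ × M₁ e ≡ true × M₂ e ≡ true
           × Σ (Fin m) λ f → inside S f ≡ true × M₁ f ≢ M₂ f)

-- Let M₁, M₂ ∈ F contain the edge e ∈ δ(S) and differ on E(S). Since S is
-- tight, e is the only edge of M₁ and of M₂ in δ(S), so M₁ and M₂ agree on
-- δ(S), and the splice M₃ (M₂ on E(S), M₁ elsewhere) is again a perfect
-- matching. It lies in F: its edges come from M₁ or M₂, and for an odd set U
-- whose cut constraint is an equality of F, M₃ and the opposite splice each
-- cross U an odd number of times (a perfect matching crosses an odd cut oddly),
-- in total |M₁ ∩ δ(U)| + |M₂ ∩ δ(U)| = 2 times, so M₃ crosses U once. The unique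
-- edge g of M₁ in δ(T) is not in E(S) ⊆ E(T), so M₁ and M₃ both contain
-- g ∈ δ(T) and differ on E(S) ⊆ E(T), contradicting the F-contractibility of T.
module Submission where

open import Defs
open import Algebra.Bundles using (CommutativeRing)
import Algebra.Properties.CommutativeSemigroup as CommutativeSemigroupProperties
open import Data.Bool using (Bool; true; false; not; if_then_else_; _xor_; _∧_)
open import Data.Bool.Properties
  using ( ∧-distribˡ-xor; ∧-zeroʳ; ∧-identityʳ; ∧-conicalˡ; ∧-conicalʳ; not-involutive
        ; xor-identityʳ; ⇔→≡; xor-∧-commutativeRing)
open import Data.Fin using (Fin; zero; suc)
open import Data.Fin.Subset using (Subset; ⁅_⁆; ∣_∣; _⊆_)
open import Data.Nat using (ℕ; zero; suc; _+_; pred)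
open import Data.Nat.Properties using (+-suc; +-comm; +-identityʳ; m+n≡0⇒m≡0; +-commutativeSemigroup)
open import Data.Product using (∃; _×_; _,_; proj₁; proj₂)
open import Data.Rational using (ℚ; 0ℚ; 1ℚ; _≤_)
import Data.Rational as ℚ
import Data.Rational.Properties as ℚₚ
open import Data.Sum using (_⊎_; inj₁; inj₂)
open import Data.Vec using ([]; _∷_; lookup)
open import Data.Vec.Properties using (lookup-replicate; []=⇒lookup; lookup⇒[]=)
open import Function using (_∘_; mk⇔)
open import Relation.Binary.PropositionalEquality

open CommutativeSemigroupProperties (CommutativeRing.+-commutativeSemigroup xor-∧-commutativeRing)
  using () renaming (interchange to xor-interchange)
open CommutativeSemigroupProperties +-commutativeSemigroup
  using () renaming (interchange to +-interchange)

true≢false : true ≡ false → ∀ {a} {A : Set a} → A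
true≢false ()

xorSum : ∀ {k} → (Fin k → Bool) → Bool
xorSum {zero}  f = false
xorSum {suc k} f = f zero xor xorSum (f ∘ suc)

xorSum-cong : ∀ {k} {f g : Fin k → Bool} → (∀ i → f i ≡ g i) → xorSum f ≡ xorSum g
xorSum-cong {zero}  f≗g = refl
xorSum-cong {suc k} f≗g = cong₂ _xor_ (f≗g zero) (xorSum-cong (f≗g ∘ suc))

xorSum-false : ∀ k → xorSum {k} (λ _ → false) ≡ false
xorSum-false zero    = refl
xorSum-false (suc k) = xorSum-false k

xorSum-xor : ∀ {k} (f g : Fin k → Bool) →
  xorSum (λ i → f i xor g i) ≡ xorSum f xor xorSum g
xorSum-xor {zero}  f g = refl
xorSum-xor {suc k} f g = trans
  (cong ((f zero xor g zero) xor_) (xorSum-xor (f ∘ suc) (g ∘ suc)))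
  (xor-interchange (f zero) (g zero) (xorSum (f ∘ suc)) (xorSum (g ∘ suc)))

∧-distribˡ-xorSum : ∀ {k} b (f : Fin k → Bool) → b ∧ xorSum f ≡ xorSum (λ i → b ∧ f i)
∧-distribˡ-xorSum {zero}  b f = ∧-zeroʳ b
∧-distribˡ-xorSum {suc k} b f = trans
  (∧-distribˡ-xor b (f zero) (xorSum (f ∘ suc)))
  (cong ((b ∧ f zero) xor_) (∧-distribˡ-xorSum b (f ∘ suc)))

xorSum-swap : ∀ {k l} (h : Fin k → Fin l → Bool) →
  xorSum (λ i → xorSum (h i)) ≡ xorSum (λ j → xorSum (λ i → h i j))
xorSum-swap {zero}  {l} h = sym (xorSum-false l)
xorSum-swap {suc k}     h = trans
  (cong (xorSum (h zero) xor_) (xorSum-swap (h ∘ suc)))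
  (sym (xorSum-xor (h zero) (λ j → xorSum (λ i → h (suc i) j))))

xorSum-⁅⁆ : ∀ {k} (f : Fin k → Bool) (u : Fin k) → xorSum (λ v → f v ∧ lookup ⁅ v ⁆ u) ≡ f u
xorSum-⁅⁆ {suc k} f zero = begin
  (f zero ∧ true) xor xorSum (λ v → f (suc v) ∧ false)
    ≡⟨ cong₂ _xor_ (∧-identityʳ (f zero)) (xorSum-cong (∧-zeroʳ ∘ f ∘ suc)) ⟩
  f zero xor xorSum {k} (λ _ → false)
    ≡⟨ cong (f zero xor_) (xorSum-false k) ⟩
  f zero xor false
    ≡⟨ xor-identityʳ (f zero) ⟩
  f zero ∎
  where open ≡-Reasoning
xorSum-⁅⁆ {suc k} f (suc u) = cong₂ _xor_
  (trans (cong (f zero ∧_) (lookup-replicate u false)) (∧-zeroʳ (f zero)))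
  (xorSum-⁅⁆ (f ∘ suc) u)

isOdd : ℕ → Bool
isOdd zero    = false
isOdd (suc k) = not (isOdd k)

isOdd-double : ∀ j → isOdd (j + j) ≡ false
isOdd-double zero    = refl
isOdd-double (suc j) = begin
  not (isOdd (j + suc j))   ≡⟨ cong (not ∘ isOdd) (+-suc j j) ⟩
  not (not (isOdd (j + j))) ≡⟨ not-involutive _ ⟩
  isOdd (j + j)             ≡⟨ isOdd-double j ⟩
  false                     ∎
  where open ≡-Reasoning

Odd⇒isOdd : ∀ {k} → Odd k → isOdd k ≡ true
Odd⇒isOdd (j , refl) = trans (cong (not ∘ isOdd ∘ (j +_)) (+-identityʳ j)) (cong not (isOdd-double j))

xorSum-lookup : ∀ {n} (S : Subset n) → xorSum (lookup S) ≡ isOdd ∣ S ∣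
xorSum-lookup []          = refl
xorSum-lookup (true ∷ S)  = cong not (xorSum-lookup S)
xorSum-lookup (false ∷ S) = xorSum-lookup S

fromBool : Bool → ℕ
fromBool b = if b then 1 else 0

xorSum≡isOdd-countℕ : ∀ {k} (f : Fin k → Bool) → xorSum f ≡ isOdd (countℕ f)
xorSum≡isOdd-countℕ {zero}  f = refl
xorSum≡isOdd-countℕ {suc k} f with f zero
... | true  = cong not (xorSum≡isOdd-countℕ (f ∘ suc))
... | false = xorSum≡isOdd-countℕ (f ∘ suc)

countℕ-cong : ∀ {k} {f g : Fin k → Bool} → (∀ i → f i ≡ g i) → countℕ f ≡ countℕ g
countℕ-cong {zero}  f≗g = refl
countℕ-cong {suc k} f≗g = cong₂ (λ b c → fromBool b + c) (f≗g zero) (countℕ-cong (f≗g ∘ suc))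

countℕ≡0⇒false : ∀ {k} (f : Fin k → Bool) → countℕ f ≡ 0 → ∀ i → f i ≡ false
countℕ≡0⇒false {suc k} f count≡0 i with f zero in f₀
countℕ≡0⇒false f ()      i       | true
countℕ≡0⇒false f count≡0 zero    | false = f₀
countℕ≡0⇒false f count≡0 (suc i) | false = countℕ≡0⇒false (f ∘ suc) count≡0 i

countℕ≡1⇒witness : ∀ {k} (f : Fin k → Bool) → countℕ f ≡ 1 → ∃ λ i → f i ≡ true
countℕ≡1⇒witness {suc k} f count≡1 with f zero in f₀
... | true  = zero , f₀
... | false = let i , fi = countℕ≡1⇒witness (f ∘ suc) count≡1 in suc i , fi

countℕ≡1⇒unique : ∀ {k} (f : Fin k → Bool) → countℕ f ≡ 1 →
  ∀ {i j} → f i ≡ true → f j ≡ true → i ≡ j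
countℕ≡1⇒unique {suc k} f count≡1 {i} {j} fi fj with f zero in f₀
countℕ≡1⇒unique f count≡1 {zero}  {zero}  fi fj | _     = refl
countℕ≡1⇒unique f count≡1 {zero}  {suc j} fi fj | true  =
  true≢false (trans (sym fj) (countℕ≡0⇒false (f ∘ suc) (cong pred count≡1) j))
countℕ≡1⇒unique f count≡1 {suc i} {_}     fi fj | true  =
  true≢false (trans (sym fi) (countℕ≡0⇒false (f ∘ suc) (cong pred count≡1) i))
countℕ≡1⇒unique f count≡1 {zero}  {_}     fi fj | false = true≢false (trans (sym fi) f₀)
countℕ≡1⇒unique f count≡1 {suc i} {zero}  fi fj | false = true≢false (trans (sym fj) f₀)
countℕ≡1⇒unique f count≡1 {suc i} {suc j} fi fj | false =
  cong suc (countℕ≡1⇒unique (f ∘ suc) count≡1 fi fj)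

countℕ-interchange : ∀ {k} (f g h j : Fin k → Bool) →
  (∀ i → fromBool (f i) + fromBool (g i) ≡ fromBool (h i) + fromBool (j i)) →
  countℕ f + countℕ g ≡ countℕ h + countℕ j
countℕ-interchange {zero}  f g h j pointwise = refl
countℕ-interchange {suc k} f g h j pointwise = begin
  (fromBool (f zero) + countℕ (f ∘ suc)) + (fromBool (g zero) + countℕ (g ∘ suc))
    ≡⟨ +-interchange (fromBool (f zero)) _ _ _ ⟩
  (fromBool (f zero) + fromBool (g zero)) + (countℕ (f ∘ suc) + countℕ (g ∘ suc))
    ≡⟨ cong₂ _+_ (pointwise zero)
                 (countℕ-interchange (f ∘ suc) (g ∘ suc) (h ∘ suc) (j ∘ suc) (pointwise ∘ suc)) ⟩
  (fromBool (h zero) + fromBool (j zero)) + (countℕ (h ∘ suc) + countℕ (j ∘ suc))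
    ≡⟨ +-interchange (fromBool (h zero)) _ _ _ ⟩
  (fromBool (h zero) + countℕ (h ∘ suc)) + (fromBool (j zero) + countℕ (j ∘ suc)) ∎
  where open ≡-Reasoning

pos+pos≡2⇒≡1 : ∀ {a b} → ∃ (λ k → a ≡ suc k) → ∃ (λ k → b ≡ suc k) → a + b ≡ 2 → a ≡ 1
pos+pos≡2⇒≡1 (k , refl) (l , refl) sum≡2 =
  cong suc (m+n≡0⇒m≡0 k (cong pred (trans (sym (+-suc k l)) (cong pred sum≡2))))

one-true⇒∧⊎xor : ∀ x y → x ≡ true ⊎ y ≡ true → x ∧ y ≡ true ⊎ x xor y ≡ true
one-true⇒∧⊎xor true true  _ = inj₁ refl
one-true⇒∧⊎xor true false _ = inj₂ refl
one-true⇒∧⊎xor false true  _ = inj₂ refl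
one-true⇒∧⊎xor false false (inj₁ ())
one-true⇒∧⊎xor false false (inj₂ ())

one-false⇒∧≡false : ∀ x y → x ≡ false ⊎ y ≡ false → x ∧ y ≡ false
one-false⇒∧≡false false _ _ = refl
one-false⇒∧≡false true false _ = refl
one-false⇒∧≡false true true  (inj₁ ())
one-false⇒∧≡false true true  (inj₂ ())

xor≡true⇒∧≡false : ∀ x y → x xor y ≡ true → x ∧ y ≡ false
xor≡true⇒∧≡false true false _ = refl
xor≡true⇒∧≡false false _ _ = refl

-- The numeral k in the shape 1 + (1 + … + 0) that sumℚ produces, so that
-- sumℚ-indicator holds by unfolding.
natToℚ : ℕ → ℚ
natToℚ zero    = 0ℚ
natToℚ (suc k) = 1ℚ ℚ.+ natToℚ k

0≤natToℚ : ∀ k → 0ℚ ≤ natToℚ k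
0≤natToℚ zero    = ℚₚ.≤-refl
0≤natToℚ (suc k) = ℚₚ.+-mono-≤ (ℚₚ.nonNegative⁻¹ 1ℚ) (0≤natToℚ k)

1≤natToℚ-suc : ∀ k → 1ℚ ≤ natToℚ (suc k)
1≤natToℚ-suc k = ℚₚ.+-monoʳ-≤ 1ℚ (0≤natToℚ k)

natToℚ≡1⇒≡1 : ∀ k → natToℚ k ≡ 1ℚ → k ≡ 1
natToℚ≡1⇒≡1 zero          ()
natToℚ≡1⇒≡1 (suc zero)    _    = refl
natToℚ≡1⇒≡1 (suc (suc k)) k≡1 =
  2≢1 (ℚₚ.≤-antisym (subst (_ ≤_) k≡1 2≤k) (1≤natToℚ-suc 1))
  where
    2≤k : 1ℚ ℚ.+ 1ℚ ≤ natToℚ (suc (suc k))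
    2≤k = ℚₚ.+-monoʳ-≤ 1ℚ (1≤natToℚ-suc k)
    2≢1 : 1ℚ ℚ.+ 1ℚ ≡ 1ℚ → suc (suc k) ≡ 1
    2≢1 ()

sumℚ-cong : ∀ {k} {f g : Fin k → ℚ} → (∀ i → f i ≡ g i) → sumℚ f ≡ sumℚ g
sumℚ-cong {zero}  f≗g = refl
sumℚ-cong {suc k} f≗g = cong₂ ℚ._+_ (f≗g zero) (sumℚ-cong (f≗g ∘ suc))

sumℚ-indicator : ∀ {k} (f : Fin k → Bool) →
  sumℚ (λ i → if f i then 1ℚ else 0ℚ) ≡ natToℚ (countℕ f)
sumℚ-indicator {zero}  f = refl
sumℚ-indicator {suc k} f with f zero
... | true  = cong (1ℚ ℚ.+_) (sumℚ-indicator (f ∘ suc))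
... | false = trans (ℚₚ.+-identityˡ _) (sumℚ-indicator (f ∘ suc))

⊆-lookup : ∀ {n} {S T : Subset n} → S ⊆ T → ∀ v → lookup S v ≡ true → lookup T v ≡ true
⊆-lookup S⊆T v v∈S = []=⇒lookup (S⊆T (lookup⇒[]= v _ v∈S))

lookup-⁅⁆ : ∀ {n} (v u : Fin n) → lookup ⁅ v ⁆ u ≡ true → u ≡ v
lookup-⁅⁆ zero    zero    _   = refl
lookup-⁅⁆ zero    (suc u) u∈v = true≢false (trans (sym u∈v) (lookup-replicate u false))
lookup-⁅⁆ (suc v) (suc u) u∈v = cong suc (lookup-⁅⁆ v u u∈v)

module _ {n : ℕ} (G : Graph n) where
  open Graph G

  crossings : (Fin m → Bool) → Subset n → ℕ
  crossings M S = countℕ (λ e → M e ∧ crosses G S e)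

  xδ-χ : ∀ M S → xδ G (χ G M) S ≡ natToℚ (crossings M S)
  xδ-χ M S = trans (sumℚ-cong χ-on-δ) (sumℚ-indicator (λ e → M e ∧ crosses G S e))
    where
      χ-on-δ : ∀ e →
        (if crosses G S e then χ G M e else 0ℚ) ≡ (if M e ∧ crosses G S e then 1ℚ else 0ℚ)
      χ-on-δ e with crosses G S e | M e
      ... | true  | true  = refl
      ... | true  | false = refl
      ... | false | true  = refl
      ... | false | false = refl

  xδ-χ≡1⇒crossings≡1 : ∀ M S → xδ G (χ G M) S ≡ 1ℚ → crossings M S ≡ 1
  xδ-χ≡1⇒crossings≡1 M S xδ≡1 = natToℚ≡1⇒≡1 _ (trans (sym (xδ-χ M S)) xδ≡1)

  -- Summing the stars δ(v) over v ∈ S counts the edges of E(S) twice and those of δ(S) once.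
  crosses-xorSum : ∀ S e → crosses G S e ≡ xorSum (λ v → lookup S v ∧ crosses G ⁅ v ⁆ e)
  crosses-xorSum S e = sym (begin
    xorSum (λ v → lookup S v ∧ (lookup ⁅ v ⁆ x xor lookup ⁅ v ⁆ y))
      ≡⟨ xorSum-cong (λ v → ∧-distribˡ-xor (lookup S v) _ _) ⟩
    xorSum (λ v → (lookup S v ∧ lookup ⁅ v ⁆ x) xor (lookup S v ∧ lookup ⁅ v ⁆ y))
      ≡⟨ xorSum-xor (λ v → lookup S v ∧ lookup ⁅ v ⁆ x) (λ v → lookup S v ∧ lookup ⁅ v ⁆ y) ⟩
    xorSum (λ v → lookup S v ∧ lookup ⁅ v ⁆ x) xor xorSum (λ v → lookup S v ∧ lookup ⁅ v ⁆ y)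
      ≡⟨ cong₂ _xor_ (xorSum-⁅⁆ (lookup S) x) (xorSum-⁅⁆ (lookup S) y) ⟩
    lookup S x xor lookup S y ∎)
    where
      open ≡-Reasoning
      x = proj₁ (ends e)
      y = proj₂ (ends e)

  crossings-parity : ∀ {M} → IsPerfectMatching G M → ∀ S → isOdd (crossings M S) ≡ isOdd ∣ S ∣
  crossings-parity {M} M-perfect S = begin
    isOdd (crossings M S)
      ≡⟨ sym (xorSum≡isOdd-countℕ (λ e → M e ∧ crosses G S e)) ⟩
    xorSum (λ e → M e ∧ crosses G S e)
      ≡⟨ xorSum-cong (λ e → cong (M e ∧_) (crosses-xorSum S e)) ⟩
    xorSum (λ e → M e ∧ xorSum (λ v → lookup S v ∧ crosses G ⁅ v ⁆ e))
      ≡⟨ xorSum-cong (λ e → ∧-distribˡ-xorSum (M e) (λ v → lookup S v ∧ crosses G ⁅ v ⁆ e)) ⟩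
    xorSum (λ e → xorSum (λ v → M e ∧ (lookup S v ∧ crosses G ⁅ v ⁆ e)))
      ≡⟨ xorSum-cong (λ e → xorSum-cong (λ v → ∧-swapˡ (M e) (lookup S v) _)) ⟩
    xorSum (λ e → xorSum (λ v → lookup S v ∧ (M e ∧ crosses G ⁅ v ⁆ e)))
      ≡⟨ xorSum-swap (λ e v → lookup S v ∧ (M e ∧ crosses G ⁅ v ⁆ e)) ⟩
    xorSum (λ v → xorSum (λ e → lookup S v ∧ (M e ∧ crosses G ⁅ v ⁆ e)))
      ≡⟨ xorSum-cong (λ v → sym (∧-distribˡ-xorSum (lookup S v) (λ e → M e ∧ crosses G ⁅ v ⁆ e))) ⟩
    xorSum (λ v → lookup S v ∧ xorSum (λ e → M e ∧ crosses G ⁅ v ⁆ e))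
      ≡⟨ xorSum-cong (λ v → cong (lookup S v ∧_) (degree-odd v)) ⟩
    xorSum (λ v → lookup S v ∧ true)
      ≡⟨ xorSum-cong (λ v → ∧-identityʳ (lookup S v)) ⟩
    xorSum (lookup S)
      ≡⟨ xorSum-lookup S ⟩
    isOdd ∣ S ∣ ∎
    where
      open ≡-Reasoning
      ∧-swapˡ : ∀ a b c → a ∧ (b ∧ c) ≡ b ∧ (a ∧ c)
      ∧-swapˡ true  b c = refl
      ∧-swapˡ false b c = sym (∧-zeroʳ b)
      degree-odd : ∀ v → xorSum (λ e → M e ∧ crosses G ⁅ v ⁆ e) ≡ true
      degree-odd v =
        trans (xorSum≡isOdd-countℕ (λ e → M e ∧ crosses G ⁅ v ⁆ e)) (cong isOdd (M-perfect v))

  odd-crossings-positive : ∀ {M} → IsPerfectMatching G M →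
    ∀ S → OddSet G S → ∃ λ k → crossings M S ≡ suc k
  odd-crossings-positive {M} M-perfect S S-odd with crossings M S | crossings-parity M-perfect S
  ... | suc k | _ = k , refl
  ... | zero  | even≡odd = true≢false (trans (sym (Odd⇒isOdd S-odd)) (sym even≡odd))

  perfectMatching⇒InPM : ∀ {M} → IsPerfectMatching G M → InPM G (χ G M)
  perfectMatching⇒InPM {M} M-perfect = degree≡1 , odd-cut≥1 , χ≥0
    where
      degree≡1 : ∀ v → xδ G (χ G M) ⁅ v ⁆ ≡ 1ℚ
      degree≡1 v = trans (xδ-χ M ⁅ v ⁆) (cong natToℚ (M-perfect v))
      odd-cut≥1 : ∀ S → OddSet G S → 1ℚ ≤ xδ G (χ G M) S
      odd-cut≥1 S S-odd with odd-crossings-positive M-perfect S S-odd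
      ... | k , crossings≡1+k =
        subst (1ℚ ≤_) (sym (trans (xδ-χ M S) (cong natToℚ crossings≡1+k))) (1≤natToℚ-suc k)
      χ≥0 : ∀ e → 0ℚ ≤ χ G M e
      χ≥0 e with M e
      ... | true  = ℚₚ.nonNegative⁻¹ 1ℚ
      ... | false = ℚₚ.≤-refl

  crossings≡1⇒edge : ∀ {M S} → crossings M S ≡ 1 → ∃ λ g → M g ≡ true × crosses G S g ≡ true
  crossings≡1⇒edge {M} {S} crossings≡1
    with countℕ≡1⇒witness (λ g → M g ∧ crosses G S g) crossings≡1
  ... | g , g∈M∩δ = g , ∧-conicalˡ (M g) _ g∈M∩δ , ∧-conicalʳ (M g) _ g∈M∩δ

  crossings≡1⇒unique : ∀ M S {e g} → crossings M S ≡ 1 →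
    M e ≡ true → crosses G S e ≡ true → M g ≡ true → crosses G S g ≡ true → e ≡ g
  crossings≡1⇒unique M S crossings≡1 Me e∈δ Mg g∈δ =
    countℕ≡1⇒unique (λ g → M g ∧ crosses G S g) crossings≡1
      (cong₂ _∧_ Me e∈δ) (cong₂ _∧_ Mg g∈δ)

  tight⇒crossings≡1 : ∀ F S M → tight G F S → PMIn G F M → crossings M S ≡ 1
  tight⇒crossings≡1 F S M (_ , S-tight) (_ , M∈F) = xδ-χ≡1⇒crossings≡1 M S (S-tight _ M∈F)

  AgreeOnCut : Subset n → (A B : Fin m → Bool) → Set
  AgreeOnCut S A B = ∀ g → crosses G S g ≡ true → A g ≡ B g

  share-cut-edge⇒agree : ∀ {S A B e} → crossings A S ≡ 1 → crossings B S ≡ 1 →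
    crosses G S e ≡ true → A e ≡ true → B e ≡ true → AgreeOnCut S A B
  share-cut-edge⇒agree {S} {A} {B} {e} A-once B-once e∈δ Ae Be g g∈δ =
    ⇔→≡ (mk⇔ (transfer A B A-once Ae Be) (transfer B A B-once Be Ae))
    where
      transfer : ∀ M N → crossings M S ≡ 1 → M e ≡ true → N e ≡ true → M g ≡ true → N g ≡ true
      transfer M N M-once Me Ne Mg =
        subst (λ h → N h ≡ true) (crossings≡1⇒unique M S M-once Me e∈δ Mg g∈δ) Ne

  crosses⇒¬inside : ∀ S g → crosses G S g ≡ true → inside G S g ≡ false
  crosses⇒¬inside S g = xor≡true⇒∧≡false (lookup S (proj₁ (ends g))) (lookup S (proj₂ (ends g)))

  inside-mono : ∀ {S T} → S ⊆ T → ∀ g → inside G S g ≡ true → inside G T g ≡ true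
  inside-mono {S} S⊆T g g∈ES = cong₂ _∧_
    (⊆-lookup S⊆T _ (∧-conicalˡ (lookup S (proj₁ (ends g))) _ g∈ES))
    (⊆-lookup S⊆T _ (∧-conicalʳ (lookup S (proj₁ (ends g))) _ g∈ES))

  crosses-superset⇒¬inside : ∀ {S T} → S ⊆ T → ∀ g → crosses G T g ≡ true → inside G S g ≡ false
  crosses-superset⇒¬inside {S} {T} S⊆T g g∈δT with inside G S g in g∈ES
  ... | false = refl
  ... | true  = true≢false (trans (sym (inside-mono S⊆T g g∈ES)) (crosses⇒¬inside T g g∈δT))

  incident-lookup : ∀ (S : Subset n) {b} v g → crosses G ⁅ v ⁆ g ≡ true → lookup S v ≡ b →
    lookup S (proj₁ (ends g)) ≡ b ⊎ lookup S (proj₂ (ends g)) ≡ b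
  incident-lookup S v g g∋v Sv with lookup ⁅ v ⁆ (proj₁ (ends g)) in x≡v
  ... | true  = inj₁ (trans (cong (lookup S) (lookup-⁅⁆ v _ x≡v)) Sv)
  ... | false = inj₂ (trans (cong (lookup S) (lookup-⁅⁆ v _ g∋v)) Sv)

  meets⇒inside⊎crosses : ∀ S g →
    lookup S (proj₁ (ends g)) ≡ true ⊎ lookup S (proj₂ (ends g)) ≡ true →
    inside G S g ≡ true ⊎ crosses G S g ≡ true
  meets⇒inside⊎crosses S g = one-true⇒∧⊎xor (lookup S (proj₁ (ends g))) (lookup S (proj₂ (ends g)))

  misses⇒¬inside : ∀ S g →
    lookup S (proj₁ (ends g)) ≡ false ⊎ lookup S (proj₂ (ends g)) ≡ false → inside G S g ≡ false
  misses⇒¬inside S g = one-false⇒∧≡false (lookup S (proj₁ (ends g))) (lookup S (proj₂ (ends g)))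

  degree-cong : ∀ {A B : Fin m → Bool} v → (∀ g → crosses G ⁅ v ⁆ g ≡ true → A g ≡ B g) →
    countℕ (λ g → A g ∧ crosses G ⁅ v ⁆ g) ≡ countℕ (λ g → B g ∧ crosses G ⁅ v ⁆ g)
  degree-cong {A} {B} v A≗B-at-v = countℕ-cong at-v
    where
      at-v : ∀ g → A g ∧ crosses G ⁅ v ⁆ g ≡ B g ∧ crosses G ⁅ v ⁆ g
      at-v g with crosses G ⁅ v ⁆ g in g∋v
      ... | true  = cong (_∧ true) (A≗B-at-v g g∋v)
      ... | false = trans (∧-zeroʳ (A g)) (sym (∧-zeroʳ (B g)))

  splice : Subset n → (A B : Fin m → Bool) → Fin m → Bool
  splice S A B g = if inside G S g then B g else A g

  splice-inside : ∀ S A B g → inside G S g ≡ true → splice S A B g ≡ B g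
  splice-inside S A B g g∈ES rewrite g∈ES = refl

  splice-outside : ∀ S A B g → inside G S g ≡ false → splice S A B g ≡ A g
  splice-outside S A B g g∉ES rewrite g∉ES = refl

  splice-perfect : ∀ S A B → IsPerfectMatching G A → IsPerfectMatching G B →
    AgreeOnCut S A B → IsPerfectMatching G (splice S A B)
  splice-perfect S A B A-perfect B-perfect agree v with lookup S v in Sv
  ... | true  = trans (degree-cong {splice S A B} {B} v like-B) (B-perfect v)
    where
      like-B : ∀ g → crosses G ⁅ v ⁆ g ≡ true → splice S A B g ≡ B g
      like-B g g∋v with meets⇒inside⊎crosses S g (incident-lookup S v g g∋v Sv)
      ... | inj₁ g∈ES = splice-inside S A B g g∈ES
      ... | inj₂ g∈δS = trans (splice-outside S A B g (crosses⇒¬inside S g g∈δS)) (agree g g∈δS)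
  ... | false = trans (degree-cong {splice S A B} {A} v like-A) (A-perfect v)
    where
      like-A : ∀ g → crosses G ⁅ v ⁆ g ≡ true → splice S A B g ≡ A g
      like-A g g∋v = splice-outside S A B g (misses⇒¬inside S g (incident-lookup S v g g∋v Sv))

  splice-crossings : ∀ S A B U →
    crossings (splice S A B) U + crossings (splice S B A) U ≡ crossings A U + crossings B U
  splice-crossings S A B U = countℕ-interchange _ _ _ _ pointwise
    where
      pointwise : ∀ g →
          fromBool (splice S A B g ∧ crosses G U g) + fromBool (splice S B A g ∧ crosses G U g)
                      ≡ fromBool (A g ∧ crosses G U g) + fromBool (B g ∧ crosses G U g)
      pointwise g with inside G S g
      ... | true  = +-comm (fromBool (B g ∧ crosses G U g)) _
      ... | false = refl

  splice-PMIn : ∀ F {S A B} → PMIn G F A → PMIn G F B → AgreeOnCut S A B →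
    PMIn G F (splice S A B)
  splice-PMIn F {S} {A} {B} (A-perfect , _ , A-zero , A-tight) (B-perfect , _ , B-zero , B-tight)
    agree =
    AB-perfect , perfectMatching⇒InPM AB-perfect , zeros , tights
    where
      AB-perfect = splice-perfect S A B A-perfect B-perfect agree
      BA-perfect = splice-perfect S B A B-perfect A-perfect (λ g g∈δ → sym (agree g g∈δ))
      zeros : ∀ e → Z F e → χ G (splice S A B) e ≡ 0ℚ
      zeros e e∈Z with inside G S e
      ... | true  = B-zero e e∈Z
      ... | false = A-zero e e∈Z
      tights : ∀ U → OddSet G U → 𝒮 F U → xδ G (χ G (splice S A B)) U ≡ 1ℚ
      tights U U-odd U∈𝒮 = trans (xδ-χ _ U) (cong natToℚ (pos+pos≡2⇒≡1
        (odd-crossings-positive AB-perfect U U-odd)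
        (odd-crossings-positive BA-perfect U U-odd)
        (trans (splice-crossings S A B U)
               (cong₂ _+_ (xδ-χ≡1⇒crossings≡1 A U (A-tight U U-odd U∈𝒮))
                          (xδ-χ≡1⇒crossings≡1 B U (B-tight U U-odd U∈𝒮))))))

lemma4p3 : (n : ℕ) (G : Graph n) (F : Face G) (S T : Subset n) →
    tight G F S → tight G F T → S ⊆ T →
    Contractible G F T → Contractible G F S
lemma4p3 _ G F S T S-tight T-tight S⊆T T-contractible e e∈δS
  (M₁ , M₂ , M₁∈F , M₂∈F , M₁e , M₂e , f , f∈ES , M₁f≢M₂f)
  with crossings≡1⇒edge G {M₁} {T} (tight⇒crossings≡1 G F T M₁ T-tight M₁∈F)
... | g , M₁g , g∈δT = T-contractible g g∈δT
  (M₁ , M₃ , M₁∈F , M₃∈F , M₁g , M₃g , f , inside-mono G S⊆T f f∈ES , M₁f≢M₃f)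
  where
    agree : AgreeOnCut G S M₁ M₂
    agree = share-cut-edge⇒agree G {S}
      (tight⇒crossings≡1 G F S M₁ S-tight M₁∈F) (tight⇒crossings≡1 G F S M₂ S-tight M₂∈F) e∈δS M₁e M₂e
    M₃ : Fin (Graph.m G) → Bool
    M₃ = splice G S M₁ M₂
    M₃∈F : PMIn G F M₃
    M₃∈F = splice-PMIn G F {S} {M₁} {M₂} M₁∈F M₂∈F agree
    M₃g : M₃ g ≡ true
    M₃g = trans (splice-outside G S M₁ M₂ g (crosses-superset⇒¬inside G S⊆T g g∈δT)) M₁g
    M₁f≢M₃f : M₁ f ≢ M₃ f
    M₁f≢M₃f M₁f≡M₃f = M₁f≢M₂f (trans M₁f≡M₃f (splice-inside G S M₁ M₂ f f∈ES))
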